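{- For any bridge $w$ and any integer $t\ge1$ such that $|K(w)|\ge2$, \[|K(w)|+\sum_{i=1}^{t}\sum_{z\in K^{(i)}_{+}(w)}|K(z)|\ \le\ \#w+\sum_{i=1}^{t}|K^{(i)}_{+}(w)|.\]
   Context: $\Sigma$ is an ordered alphabet, $\$\notin\Sigma$, and $T$ is a string of length $n\ge3$ with $T[1]=T[n]=\$$ and $T[2..n-1]\in\Sigma^*$. $\#w$ denotes the number of occurrences of $w$ as a substring of $T$. For a string $w$, $R(w)$ is the number of maximal runs of equal characters in $w$. A string $w\in(\Sigma\cup\{\$\})^*$ with $|w|\ge2$ is a bridge if $w[1]\neq w[2]$ and $w[|w|-1]\neq w[|w|]$; $\mathcal{B}$ is the set of bridges that are substrings of $T$. For a string $w$ with $R(w)\ge3$, $w^{(1)}$ is obtained from $w$ by deleting its first and last runs and then shortening the new first and last runs to length 1; $w^{(1)}=\varepsilon$ if $R(w)\le2$; $w^{(t)}=(w^{(t-1)})^{(1)}$ for $t\ge2$. For $t\ge1$, $K^{(t)}(w)=\{w'\in\mathcal{B}\mid w'^{(t)}=w\}$, $K(w)=K^{(1)}(w)$, and $K^{(t)}_+(w)=\{w'\in K^{(t)}(w)\mid |K(w')|\ge2\}$. -}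

module Defs where

open import Data.Nat using (ℕ; zero; suc; _+_; _≤_; _≤?_; _∸_)
open import Data.Bool using (Bool; true; false; if_then_else_)
open import Data.List using (List; []; _∷_; _++_; [_]; map; length; filter; deduplicate; upTo; concatMap; concat; replicate; take; drop; reverse)
open import Data.Nat.ListAction using (sum)
open import Data.Maybe using (Maybe; just; nothing)
open import Data.Product using (_×_; _,_)
open import Data.Empty using (⊥)
open import Relation.Nullary using (¬_; Dec; yes; no; does; _×-dec_; ¬?)
open import Relation.Binary.PropositionalEquality using (_≡_; _≢_)
open import Relation.Binary.Definitions using (DecidableEquality)
import Data.List.Properties as LP
import Data.Maybe.Properties as MP

-- Strings over an alphabet Σ = A (with decidable equality); the character set
-- Σ ∪ {$} is  Maybe A,  where  $ = nothing  and  c ∈ Σ  is  just c.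
module Strings {A : Set} (_≟A_ : DecidableEquality A) where

  Char : Set
  Char = Maybe A

  _≟_ : DecidableEquality Char
  _≟_ = MP.≡-dec _≟A_

  _≟s_ : DecidableEquality (List Char)
  _≟s_ = LP.≡-dec _≟_

  Text : List A → List Char
  Text s = nothing ∷ map just s ++ [ nothing ]

  isPrefix : List Char → List Char → Bool
  isPrefix [] _ = true
  isPrefix (x ∷ xs) [] = false
  isPrefix (x ∷ xs) (y ∷ ys) = if does (x ≟ y) then isPrefix xs ys else false

  occ : List Char → List Char → ℕ
  occ T w = length (filter (λ i → Data.Bool._≟_ (isPrefix w (drop i T)) true) (upTo (length T)))
    where import Data.Bool

  substrings : List Char → List (List Char)
  substrings T =
    deduplicate _≟s_
      (concatMap (λ i → map (λ j → take (suc j) (drop i T)) (upTo (length T ∸ i)))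
                 (upTo (length T)))

  headsDiffer : List Char → Set
  headsDiffer (x ∷ y ∷ _) = x ≢ y
  headsDiffer _ = ⊥

  headsDiffer? : (w : List Char) → Dec (headsDiffer w)
  headsDiffer? [] = no (λ ())
  headsDiffer? (x ∷ []) = no (λ ())
  headsDiffer? (x ∷ y ∷ _) = ¬? (x ≟ y)

  IsBridge : List Char → Set
  IsBridge w = headsDiffer w × headsDiffer (reverse w)

  isBridge? : (w : List Char) → Dec (IsBridge w)
  isBridge? w = headsDiffer? w ×-dec headsDiffer? (reverse w)

  Bridges : List Char → List (List Char)
  Bridges T = filter isBridge? (substrings T)

  runs : List Char → List (Char × ℕ)
  runs [] = []
  runs (x ∷ xs) with runs xs
  ... | [] = (x , 1) ∷ []
  ... | (y , k) ∷ rs = if does (x ≟ y) then (y , suc k) ∷ rs else (x , 1) ∷ (y , k) ∷ rs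

  R : List Char → ℕ
  R w = length (runs w)

  expand : List (Char × ℕ) → List Char
  expand [] = []
  expand ((c , k) ∷ rs) = replicate k c ++ expand rs

  dropLast : {X : Set} → List X → List X
  dropLast [] = []
  dropLast (x ∷ []) = []
  dropLast (x ∷ y ∷ xs) = x ∷ dropLast (y ∷ xs)

  dropFirst : {X : Set} → List X → List X
  dropFirst [] = []
  dropFirst (x ∷ xs) = xs

  lastToOne : List (Char × ℕ) → List (Char × ℕ)
  lastToOne [] = []
  lastToOne ((c , k) ∷ []) = (c , 1) ∷ []
  lastToOne (r ∷ r' ∷ rs) = r ∷ lastToOne (r' ∷ rs)

  firstToOne : List (Char × ℕ) → List (Char × ℕ)
  firstToOne [] = []
  firstToOne ((c , k) ∷ rs) = (c , 1) ∷ rs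

  step : List Char → List Char
  step w with 3 ≤? R w
  ... | no _ = []
  ... | yes _ = expand (lastToOne (firstToOne (dropLast (dropFirst (runs w)))))

  iter : ℕ → List Char → List Char
  iter zero w = w
  iter (suc t) w = step (iter t w)

  Kt : List Char → ℕ → List Char → List (List Char)
  Kt T t w = filter (λ w' → iter t w' ≟s w) (Bridges T)

  K : List Char → List Char → List (List Char)
  K T w = Kt T 1 w

  Kt+ : List Char → ℕ → List Char → List (List Char)
  Kt+ T t w = filter (λ w' → 2 ≤? length (K T w')) (Kt T t w)

  sumFrom1 : ℕ → (ℕ → ℕ) → ℕ
  sumFrom1 zero f = 0
  sumFrom1 (suc t) f = sumFrom1 t f + f (suc t)

  lhsSum : List Char → ℕ → List Char → ℕ
  lhsSum T t w = sumFrom1 t (λ i → sum (map (λ z → length (K T z)) (Kt+ T i w)))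

  rhsSum : List Char → ℕ → List Char → ℕ
  rhsSum T t w = sumFrom1 t (λ i → length (Kt+ T i w))

module Submission where

-- Every x ∈ K(z) has the form c a^k z b^m d with c ≠ a and d ≠ b, so an occurrence of x contains one of z
-- at offset k + 1, and an occurrence of z determines x (extend its outer runs to their full length).
-- Hence Σ_{x ∈ K(z)} #x ≤ #z, i.e. |K(z)| + Σ_{x ∈ K(z)} (#x − 1) ≤ #z for every nonempty z.
-- With S_i = Σ_{x ∈ K^(i)(w)} (#x − 1), every x ∈ K^(i+1)(w) lies in K(z) for z = x^(1) ∈ K^(i)(w); using
-- the bound for z ∈ K^(i)_+(w) and its consequence Σ_{x ∈ K(z)} (#x − 1) ≤ #z − 1 for the other z gives
-- Σ_{z ∈ K^(i)_+(w)} |K(z)| + S_(i+1) ≤ S_i + |K^(i)_+(w)|, and these telescope from |K(w)| + S_1 ≤ #w.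

open import Defs
open import Data.Nat using (ℕ; zero; suc; _+_; _≤_; _<_; _∸_; z≤n; s≤s; _≤?_; s≤s⁻¹)
open import Data.Nat.Properties hiding (_≟_)
open import Data.List
  using (List; []; _∷_; _++_; _∷ʳ_; [_]; map; length; filter; replicate; reverse; take; drop; concatMap; upTo)
open import Data.List.Properties
  using ( map-cong; length-map; length-replicate; length-take; length-drop; length-++; take++drop≡id
        ; ++-assoc; ++-identityʳ; ++-cancelˡ; reverse-++; unfold-reverse; ∷-injective; ∷-injectiveʳ; ∷ʳ-injectiveʳ)
open import Data.List.Relation.Unary.All as All using (All; []; _∷_)
open import Data.List.Relation.Unary.All.Properties using (∷ʳ⁻)
open import Data.List.Relation.Unary.Linked as Linked using (Linked; []; [-]; _∷_)
open import Data.List.Relation.Unary.Unique.Propositional using (Unique)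
import Data.List.Relation.Unary.Unique.Propositional.Properties as Unique
open import Data.List.Relation.Unary.Unique.DecPropositional.Properties using (deduplicate-!)
open import Data.List.Relation.Unary.AllPairs using ([]; _∷_)
open import Data.List.Relation.Unary.Any using (here; there)
open import Data.List.Reverse using (Reverse; reverseView; []; _∶_∶ʳ_)
open import Data.List.Relation.Binary.Subset.Propositional using (_⊆_)
open import Data.List.Membership.Propositional.Properties
  using ( ∈-∃++; ∈-++⁻; ∈-++⁺ˡ; ∈-++⁺ʳ; ∈-filter⁻; ∈-filter⁺; ∈-upTo⁻; ∈-upTo⁺; ∈-length; ∈-map⁻; ∈-map⁺
        ; ∈-concatMap⁻; ∈-concatMap⁺; ∈-deduplicate⁻; ∈-deduplicate⁺)
open import Data.List.Membership.Propositional using (_∈_; find; lose)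
open import Data.Nat.ListAction using (sum)
open import Data.Product using (_×_; _,_; ∃; ∃₂; proj₁; proj₂)
open import Data.Sum using (inj₁; inj₂)
open import Data.Empty using (⊥-elim)
open import Data.Bool using (true; if_then_else_) renaming (_≟_ to _≟ᵇ_)
open import Function using (_∘_; id; _on_)
open import Relation.Nullary using (¬_; yes; no; does)
open import Relation.Unary using (Decidable)
open import Relation.Binary.Definitions using (DecidableEquality)
open import Algebra.Properties.CommutativeSemigroup +-commutativeSemigroup using (interchange; x∙yz≈y∙xz)
open import Relation.Binary.PropositionalEquality hiding ([_])

private variable
  X Y : Set

++-injective : ∀ (xs xs′ : List X) {ys ys′} → length xs ≡ length xs′ →
  xs ++ ys ≡ xs′ ++ ys′ → xs ≡ xs′ × ys ≡ ys′
++-injective [] [] _ eq = refl , eq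
++-injective (x ∷ xs) (x′ ∷ xs′) len eq with ∷-injective eq
... | refl , eq′ with ++-injective xs xs′ (suc-injective len) eq′
...   | refl , refl = refl , refl

long≢[] : ∀ {xs : List X} → 2 ≤ length xs → xs ≢ []
long≢[] {xs = []} ()

length-<-++-∷ : ∀ (xs : List X) {y ys} → length xs < length (xs ++ y ∷ ys)
length-<-++-∷ xs {ys = ys} = subst (length xs <_) (sym (length-++ xs)) (m<m+n (length xs) (s≤s z≤n))

drop-length-++ : ∀ (xs : List X) {ys} → drop (length xs) (xs ++ ys) ≡ ys
drop-length-++ [] = refl
drop-length-++ (x ∷ xs) = drop-length-++ xs

take-length-++ : ∀ (xs : List X) {ys} → take (length xs) (xs ++ ys) ≡ xs
take-length-++ [] = refl
take-length-++ (x ∷ xs) = cong (x ∷_) (take-length-++ xs)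

replicate-∷ : ∀ n (a : X) ys → a ∷ replicate n a ++ ys ≡ replicate n a ++ a ∷ ys
replicate-∷ zero a ys = refl
replicate-∷ (suc n) a ys = cong (a ∷_) (replicate-∷ n a ys)

reverse-replicate : ∀ n (a : X) → reverse (replicate n a) ≡ replicate n a
reverse-replicate zero a = refl
reverse-replicate (suc n) a = begin
  reverse (a ∷ replicate n a)   ≡⟨ unfold-reverse a (replicate n a) ⟩
  reverse (replicate n a) ∷ʳ a  ≡⟨ cong (_∷ʳ a) (reverse-replicate n a) ⟩
  replicate n a ∷ʳ a            ≡⟨ replicate-∷ n a [] ⟨
  a ∷ replicate n a ++ []       ≡⟨ cong (a ∷_) (++-identityʳ (replicate n a)) ⟩
  a ∷ replicate n a             ∎
  where open ≡-Reasoning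

replicate-++-injective : ∀ {a y y′ : X} k k′ {ys ys′} → y ≢ a → y′ ≢ a →
  replicate k a ++ y ∷ ys ≡ replicate k′ a ++ y′ ∷ ys′ → k ≡ k′ × y ≡ y′
replicate-++-injective zero zero _ _ refl = refl , refl
replicate-++-injective zero (suc k′) y≢a _ refl = ⊥-elim (y≢a refl)
replicate-++-injective (suc k) zero _ y′≢a refl = ⊥-elim (y′≢a refl)
replicate-++-injective (suc k) (suc k′) y≢a y′≢a eq
  with replicate-++-injective k k′ y≢a y′≢a (∷-injectiveʳ eq)
... | refl , refl = refl , refl

++-replicate-injective : ∀ {a y y′ : X} xs xs′ k k′ → y ≢ a → y′ ≢ a →
  xs ++ y ∷ replicate k a ≡ xs′ ++ y′ ∷ replicate k′ a → k ≡ k′ × y ≡ y′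
++-replicate-injective {a = a} {y} {y′} xs xs′ k k′ y≢a y′≢a eq =
  replicate-++-injective k k′ y≢a y′≢a (begin
    replicate k a ++ y ∷ reverse xs    ≡⟨ reversed xs y k ⟨
    reverse (xs ++ y ∷ replicate k a)  ≡⟨ cong reverse eq ⟩
    reverse (xs′ ++ y′ ∷ replicate k′ a) ≡⟨ reversed xs′ y′ k′ ⟩
    replicate k′ a ++ y′ ∷ reverse xs′ ∎)
  where
  open ≡-Reasoning
  reversed : ∀ zs z n → reverse (zs ++ z ∷ replicate n a) ≡ replicate n a ++ z ∷ reverse zs
  reversed zs z n = begin
    reverse (zs ++ z ∷ replicate n a)              ≡⟨ reverse-++ zs (z ∷ replicate n a) ⟩
    reverse (z ∷ replicate n a) ++ reverse zs      ≡⟨ cong (_++ reverse zs) (unfold-reverse z (replicate n a)) ⟩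
    (reverse (replicate n a) ∷ʳ z) ++ reverse zs
      ≡⟨ cong (λ r → (r ∷ʳ z) ++ reverse zs) (reverse-replicate n a) ⟩
    (replicate n a ∷ʳ z) ++ reverse zs             ≡⟨ ++-assoc (replicate n a) [ z ] (reverse zs) ⟩
    replicate n a ++ z ∷ reverse zs                ∎

regroup-++ : ∀ l (c : X) as z bs d r →
  l ++ (c ∷ as ++ z ++ bs ++ d ∷ []) ++ r ≡ (l ++ c ∷ as) ++ z ++ bs ++ d ∷ r
regroup-++ l c as z bs d r = begin
  l ++ (c ∷ as ++ z ++ bs ++ d ∷ []) ++ r   ≡⟨ cong (λ u → l ++ c ∷ u) (++-assoc as _ r) ⟩
  l ++ c ∷ as ++ (z ++ bs ++ d ∷ []) ++ r   ≡⟨ cong (λ u → l ++ c ∷ as ++ u) (++-assoc z _ r) ⟩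
  l ++ c ∷ as ++ z ++ (bs ++ d ∷ []) ++ r   ≡⟨ cong (λ u → l ++ c ∷ as ++ z ++ u) (++-assoc bs _ r) ⟩
  l ++ (c ∷ as) ++ z ++ bs ++ d ∷ r         ≡⟨ ++-assoc l (c ∷ as) _ ⟨
  (l ++ c ∷ as) ++ z ++ bs ++ d ∷ r         ∎
  where open ≡-Reasoning

length-++-∷-replicate : ∀ l (c a : X) k → length (l ++ c ∷ replicate k a) ≡ length l + suc k
length-++-∷-replicate l c a k = trans (length-++ l) (cong (λ n → length l + suc n) (length-replicate k))

-- c a^k z b^m d with c ≢ a and d ≢ b is recovered from z and its position length l + suc k.
decomposition-unique : ∀ {c c′ a b d d′ : X} {k k′ m m′ : ℕ} {x x′ z l l′ r r′ : List X} →
  c ≢ a → c′ ≢ a → d ≢ b → d′ ≢ b →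
  x ≡ c ∷ replicate k a ++ z ++ replicate m b ++ d ∷ [] →
  x′ ≡ c′ ∷ replicate k′ a ++ z ++ replicate m′ b ++ d′ ∷ [] →
  l ++ x ++ r ≡ l′ ++ x′ ++ r′ → length l + suc k ≡ length l′ + suc k′ → x ≡ x′
decomposition-unique {c = c} {c′} {a} {b} {d} {d′} {k} {k′} {m} {m′} {z = z} {l} {l′} {r} {r′}
  c≢a c′≢a d≢b d′≢b refl refl eq position
  with ++-injective (l ++ c ∷ replicate k a) (l′ ++ c′ ∷ replicate k′ a)
         (trans (length-++-∷-replicate l c a k) (trans position (sym (length-++-∷-replicate l′ c′ a k′))))
         (trans (sym (regroup-++ l c _ z _ d r)) (trans eq (regroup-++ l′ c′ _ z _ d′ r′)))
... | left≡ , right≡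
  with ++-replicate-injective l l′ k k′ c≢a c′≢a left≡
     | replicate-++-injective m m′ d≢b d′≢b
         (++-cancelˡ z (replicate m b ++ d ∷ r) (replicate m′ b ++ d′ ∷ r′) right≡)
... | refl , refl | refl , refl = refl

Linked-∷ʳ⁻ : ∀ {R : X → X → Set} {xs x} → Linked R (xs ∷ʳ x) → Linked R xs
Linked-∷ʳ⁻ {xs = []} _ = []
Linked-∷ʳ⁻ {xs = _ ∷ []} _ = [-]
Linked-∷ʳ⁻ {xs = _ ∷ _ ∷ _} (r ∷ l) = r ∷ Linked-∷ʳ⁻ l

Linked-last : ∀ {R : X → X → Set} {xs x y} → Linked R (xs ∷ʳ x ∷ʳ y) → R x y
Linked-last {xs = []} (r ∷ _) = r
Linked-last {xs = _ ∷ _} l = Linked-last (Linked.tail l)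

-- Counting

Unique⇒length-≤ : {xs ys : List X} → Unique xs → xs ⊆ ys → length xs ≤ length ys
Unique⇒length-≤ {xs = []} _ _ = z≤n
Unique⇒length-≤ {xs = x ∷ xs} {ys} (x∉xs ∷ u) xs⊆ys with ∈-∃++ (xs⊆ys (here refl))
... | pre , post , refl = begin
  suc (length xs)               ≤⟨ s≤s (Unique⇒length-≤ u xs⊆pre++post) ⟩
  suc (length (pre ++ post))    ≡⟨ cong suc (length-++ pre) ⟩
  suc (length pre + length post) ≡⟨ +-suc (length pre) (length post) ⟨
  length pre + length (x ∷ post) ≡⟨ length-++ pre ⟨
  length (pre ++ x ∷ post)      ∎
  where
  open ≤-Reasoning
  xs⊆pre++post : xs ⊆ pre ++ post
  xs⊆pre++post {y} y∈xs with ∈-++⁻ pre (xs⊆ys (there y∈xs))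
  ... | inj₁ y∈pre = ∈-++⁺ˡ y∈pre
  ... | inj₂ (here refl) = ⊥-elim (All.lookup x∉xs y∈xs refl)
  ... | inj₂ (there y∈post) = ∈-++⁺ʳ pre y∈post

disjoint-sum-length≤ : (I : X → List Y) {L : List X} {P : List Y} → Unique L →
  (∀ {x} → x ∈ L → Unique (I x)) →
  (∀ {x x′ y} → x ∈ L → x′ ∈ L → y ∈ I x → y ∈ I x′ → x ≡ x′) →
  (∀ {x} → x ∈ L → I x ⊆ P) →
  sum (map (λ x → length (I x)) L) ≤ length P
disjoint-sum-length≤ I {L} {P} uL uI disj I⊆P =
  subst (_≤ length P) (length-concatMap L) (Unique⇒length-≤ (unique L uL id) (concatMap-⊆ L id))
  where
  length-concatMap : ∀ L′ → length (concatMap I L′) ≡ sum (map (λ x → length (I x)) L′)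
  length-concatMap [] = refl
  length-concatMap (x ∷ L′) = trans (length-++ (I x)) (cong (length (I x) +_) (length-concatMap L′))
  concatMap-⁻ : ∀ L′ {y} → y ∈ concatMap I L′ → ∃ λ x → x ∈ L′ × y ∈ I x
  concatMap-⁻ (x ∷ L′) y∈ with ∈-++⁻ (I x) y∈
  ... | inj₁ y∈Ix = x , here refl , y∈Ix
  ... | inj₂ y∈rest with concatMap-⁻ L′ y∈rest
  ...   | x′ , x′∈ , y∈Ix′ = x′ , there x′∈ , y∈Ix′
  unique : ∀ L′ → Unique L′ → L′ ⊆ L → Unique (concatMap I L′)
  unique [] _ _ = []
  unique (x ∷ L′) (x∉ ∷ u) sub = Unique.++⁺ (uI (sub (here refl))) (unique L′ u (sub ∘ there)) disjoint
    where
    disjoint : ∀ {y} → ¬ (y ∈ I x × y ∈ concatMap I L′)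
    disjoint (y∈Ix , y∈rest) with concatMap-⁻ L′ y∈rest
    ... | x′ , x′∈ , y∈Ix′ =
      All.lookup x∉ x′∈ (disj (sub (here refl)) (sub (there x′∈)) y∈Ix y∈Ix′)
  concatMap-⊆ : ∀ L′ → L′ ⊆ L → concatMap I L′ ⊆ P
  concatMap-⊆ L′ sub y∈ with concatMap-⁻ L′ y∈
  ... | x , x∈ , y∈Ix = I⊆P (sub x∈) y∈Ix

sum-map-+ : ∀ (f g : X → ℕ) xs → sum (map (λ x → f x + g x) xs) ≡ sum (map f xs) + sum (map g xs)
sum-map-+ f g [] = refl
sum-map-+ f g (x ∷ xs) = trans (cong (f x + g x +_) (sum-map-+ f g xs)) (interchange (f x) (g x) _ _)

length+sum-pred≡sum : ∀ (f : X → ℕ) xs → (∀ {x} → x ∈ xs → 1 ≤ f x) →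
  length xs + sum (map (λ x → f x ∸ 1) xs) ≡ sum (map f xs)
length+sum-pred≡sum f [] _ = refl
length+sum-pred≡sum f (x ∷ xs) pos = begin
  suc (length xs + (f x ∸ 1 + rest))  ≡⟨ cong suc (x∙yz≈y∙xz (length xs) (f x ∸ 1) rest) ⟩
  suc (f x ∸ 1 + (length xs + rest))  ≡⟨ cong (λ n → suc (f x ∸ 1 + n)) (length+sum-pred≡sum f xs (pos ∘ there)) ⟩
  suc (f x ∸ 1) + sum (map f xs)
    ≡⟨ cong (_+ sum (map f xs)) (trans (+-comm 1 (f x ∸ 1)) (m∸n+n≡m (pos (here refl)))) ⟩
  f x + sum (map f xs)                ∎
  where
  open ≡-Reasoning
  rest = sum (map (λ x → f x ∸ 1) xs)

length+sum≤suc⇒sum≤ : ∀ (f : X → ℕ) xs {n} → length xs + sum (map f xs) ≤ n + 1 → sum (map f xs) ≤ n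
length+sum≤suc⇒sum≤ f [] _ = z≤n
length+sum≤suc⇒sum≤ f (x ∷ xs) {n} ≤n+1 =
  m+n≤o⇒n≤o (length xs) (s≤s⁻¹ (subst (suc (length xs) + sum (map f (x ∷ xs)) ≤_) (+-comm n 1) ≤n+1))

sum-filter-bound : ∀ {P : X → Set} (P? : Decidable P) (f g h : X → ℕ) xs →
  (∀ {x} → x ∈ xs → P x → f x + g x ≤ h x + 1) →
  (∀ {x} → x ∈ xs → ¬ P x → g x ≤ h x) →
  sum (map f (filter P? xs)) + sum (map g xs) ≤ sum (map h xs) + length (filter P? xs)
sum-filter-bound P? f g h [] _ _ = z≤n
sum-filter-bound P? f g h (x ∷ xs) onP offP with P? x
... | yes px = begin
  (f x + F) + (g x + G)  ≡⟨ interchange (f x) F (g x) G ⟩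
  (f x + g x) + (F + G)  ≤⟨ +-mono-≤ (onP (here refl) px) IH ⟩
  (h x + 1) + (H + N)    ≡⟨ interchange (h x) 1 H N ⟩
  (h x + H) + suc N      ∎
  where
  open ≤-Reasoning
  F = sum (map f (filter P? xs)); G = sum (map g xs); H = sum (map h xs); N = length (filter P? xs)
  IH = sum-filter-bound P? f g h xs (onP ∘ there) (offP ∘ there)
... | no ¬px = begin
  F + (g x + G)   ≡⟨ x∙yz≈y∙xz F (g x) G ⟩
  g x + (F + G)   ≤⟨ +-mono-≤ (offP (here refl) ¬px) IH ⟩
  h x + (H + N)   ≡⟨ +-assoc (h x) H N ⟨
  (h x + H) + N   ∎
  where
  open ≤-Reasoning
  F = sum (map f (filter P? xs)); G = sum (map g xs); H = sum (map h xs); N = length (filter P? xs)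
  IH = sum-filter-bound P? f g h xs (onP ∘ there) (offP ∘ there)

sum-filter≤sum-fibres : ∀ {P : X → Set} (P? : Decidable P) (_≟_ : DecidableEquality Y) (π : X → Y)
  (f : X → ℕ) (zs : List Y) xs → (∀ {x} → x ∈ xs → P x → π x ∈ zs) →
  sum (map f (filter P? xs)) ≤ sum (map (λ z → sum (map f (filter (λ x → π x ≟ z) xs))) zs)
sum-filter≤sum-fibres P? _≟_ π f zs [] _ = z≤n
sum-filter≤sum-fibres {Y = Y} P? _≟_ π f zs (x ∷ xs) P⇒π∈ = begin
  sum (map f (filter P? (x ∷ xs)))      ≤⟨ head-bound ⟩
  sum (map δ zs) + sum (map fibre zs)   ≡⟨ sum-map-+ δ fibre zs ⟨
  sum (map (λ z → δ z + fibre z) zs)    ≡⟨ cong sum (map-cong split zs) ⟩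
  sum (map (λ z → sum (map f (filter (λ x′ → π x′ ≟ z) (x ∷ xs)))) zs) ∎
  where
  open ≤-Reasoning
  δ : Y → ℕ
  δ z = if does (π x ≟ z) then f x else 0
  fibre : Y → ℕ
  fibre z = sum (map f (filter (λ x′ → π x′ ≟ z) xs))
  split : ∀ z → δ z + fibre z ≡ sum (map f (filter (λ x′ → π x′ ≟ z) (x ∷ xs)))
  split z with π x ≟ z
  ... | yes _ = refl
  ... | no _ = refl
  δ-picks : ∀ {zs′} → π x ∈ zs′ → f x ≤ sum (map δ zs′)
  δ-picks {z ∷ _} (here refl) with π x ≟ π x
  ... | yes _ = m≤m+n (f x) _
  ... | no π≢π = ⊥-elim (π≢π refl)
  δ-picks {z ∷ _} (there π∈) = ≤-trans (δ-picks π∈) (m≤n+m _ (δ z))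
  IH = sum-filter≤sum-fibres P? _≟_ π f zs xs (P⇒π∈ ∘ there)
  head-bound : sum (map f (filter P? (x ∷ xs))) ≤ sum (map δ zs) + sum (map fibre zs)
  head-bound with P? x
  ... | yes px = +-mono-≤ (δ-picks (P⇒π∈ (here refl) px)) IH
  ... | no _ = ≤-trans IH (m≤n+m _ _)

module _ {A : Set} (_≟A_ : DecidableEquality A) where
  open Strings _≟A_

  telescope : ∀ {c o} (a b s : ℕ → ℕ) → c + s 1 ≤ o →
    (∀ i → a i + s (suc i) ≤ s i + b i) →
    ∀ t → c + sumFrom1 t a + s (suc t) ≤ o + sumFrom1 t b
  telescope {c} {o} a b s base layer zero = begin
    c + 0 + s 1  ≡⟨ cong (_+ s 1) (+-identityʳ c) ⟩
    c + s 1      ≤⟨ base ⟩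
    o            ≡⟨ +-identityʳ o ⟨
    o + 0        ∎
    where open ≤-Reasoning
  telescope {c} {o} a b s base layer (suc t) = begin
    c + (Σa + a t′) + s (suc t′)      ≡⟨ cong (_+ s (suc t′)) (+-assoc c Σa (a t′)) ⟨
    c + Σa + a t′ + s (suc t′)        ≡⟨ +-assoc (c + Σa) (a t′) (s (suc t′)) ⟩
    c + Σa + (a t′ + s (suc t′))      ≤⟨ +-monoʳ-≤ (c + Σa) (layer t′) ⟩
    c + Σa + (s t′ + b t′)            ≡⟨ +-assoc (c + Σa) (s t′) (b t′) ⟨
    c + Σa + s t′ + b t′              ≤⟨ +-monoˡ-≤ (b t′) (telescope a b s base layer t) ⟩
    o + Σb + b t′                     ≡⟨ +-assoc o Σb (b t′) ⟩
    o + (Σb + b t′)                   ∎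
    where
    open ≤-Reasoning
    t′ = suc t
    Σa = sumFrom1 t a
    Σb = sumFrom1 t b

  -- Runs

  dropLast-∷ʳ : ∀ (xs : List X) {x} → dropLast (xs ∷ʳ x) ≡ xs
  dropLast-∷ʳ [] = refl
  dropLast-∷ʳ (_ ∷ []) = refl
  dropLast-∷ʳ (y ∷ y′ ∷ xs) = cong (y ∷_) (dropLast-∷ʳ (y′ ∷ xs))

  lastToOne-∷ʳ : ∀ rs b L → lastToOne (rs ∷ʳ (b , L)) ≡ rs ∷ʳ (b , 1)
  lastToOne-∷ʳ [] b L = refl
  lastToOne-∷ʳ (_ ∷ []) b L = refl
  lastToOne-∷ʳ (r ∷ r′ ∷ rs) b L = cong (r ∷_) (lastToOne-∷ʳ (r′ ∷ rs) b L)

  expand-++ : ∀ rs rs′ → expand (rs ++ rs′) ≡ expand rs ++ expand rs′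
  expand-++ [] rs′ = refl
  expand-++ ((c , k) ∷ rs) rs′ =
    trans (cong (replicate k c ++_) (expand-++ rs rs′)) (sym (++-assoc (replicate k c) (expand rs) (expand rs′)))

  reverse-expand-∷ʳ : ∀ rs e n → reverse (expand (rs ∷ʳ (e , n))) ≡ replicate n e ++ reverse (expand rs)
  reverse-expand-∷ʳ rs e n = begin
    reverse (expand (rs ∷ʳ (e , n)))                ≡⟨ cong reverse (expand-++ rs [ e , n ]) ⟩
    reverse (expand rs ++ replicate n e ++ [])      ≡⟨ reverse-++ (expand rs) (replicate n e ++ []) ⟩
    reverse (replicate n e ++ []) ++ reverse (expand rs)
      ≡⟨ cong (λ r → reverse r ++ reverse (expand rs)) (++-identityʳ (replicate n e)) ⟩
    reverse (replicate n e) ++ reverse (expand rs)  ≡⟨ cong (_++ reverse (expand rs)) (reverse-replicate n e) ⟩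
    replicate n e ++ reverse (expand rs)            ∎
    where open ≡-Reasoning

  Canonical : List (Char × ℕ) → Set
  Canonical rs = All (λ r → 1 ≤ proj₂ r) rs × Linked (_≢_ on proj₁) rs

  runs-canonical : ∀ xs → Canonical (runs xs)
  runs-canonical [] = [] , []
  runs-canonical (x ∷ xs) with runs xs | runs-canonical xs
  ... | [] | _ = s≤s z≤n ∷ [] , [-]
  ... | (y , k) ∷ rs | 1≤k ∷ pos , linked with x ≟ y
  ...   | yes refl = s≤s z≤n ∷ pos , relength linked
    where
    relength : ∀ {rs} → Linked (_≢_ on proj₁) ((y , k) ∷ rs) → Linked (_≢_ on proj₁) ((y , suc k) ∷ rs)
    relength [-] = [-]
    relength (y≢ ∷ l) = y≢ ∷ l
  ...   | no x≢y = s≤s z≤n ∷ 1≤k ∷ pos , x≢y ∷ linked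

  expand-runs : ∀ xs → expand (runs xs) ≡ xs
  expand-runs [] = refl
  expand-runs (x ∷ xs) with runs xs | expand-runs xs
  ... | [] | eq = cong (x ∷_) eq
  ... | (y , k) ∷ rs | eq with x ≟ y
  ...   | yes refl = cong (x ∷_) eq
  ...   | no _ = cong (x ∷_) eq

  data Shape : List (Char × ℕ) → Set where
    three : ∀ c k a K d l → Shape ((c , k) ∷ (a , K) ∷ (d , l) ∷ [])
    more  : ∀ c k a K M b L d l → Shape (((c , k) ∷ (a , K) ∷ M ∷ʳ (b , L)) ∷ʳ (d , l))

  shape : ∀ rs → 3 ≤ length rs → Shape rs
  shape [] ()
  shape (_ ∷ []) (s≤s ())
  shape ((c , k) ∷ (a , K) ∷ rs) _ with reverseView rs
  shape (_ ∷ _ ∷ .[]) (s≤s (s≤s ())) | []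
  ... | rs′ ∶ v ∶ʳ (d , l) with v
  ...   | [] = three c k a K d l
  ...   | M ∶ _ ∶ʳ (b , L) = more c k a K M b L d l

  trimRuns : List (Char × ℕ) → List Char
  trimRuns rs = expand (lastToOne (firstToOne (dropLast (dropFirst rs))))

  step-trimRuns : ∀ x → 3 ≤ R x → step x ≡ trimRuns (runs x)
  step-trimRuns x 3≤R with 3 ≤? R x
  ... | yes _ = refl
  ... | no 3≰R = ⊥-elim (3≰R 3≤R)

  step≢[]⇒3≤R : ∀ x → step x ≢ [] → 3 ≤ R x
  step≢[]⇒3≤R x nz with 3 ≤? R x
  ... | yes 3≤R = 3≤R
  ... | no _ = ⊥-elim (nz refl)

  trimRuns-more : ∀ c k a K M b L d l →
    trimRuns (((c , k) ∷ (a , K) ∷ M ∷ʳ (b , L)) ∷ʳ (d , l)) ≡ a ∷ expand M ++ b ∷ []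
  trimRuns-more c k a K M b L d l = begin
    expand (lastToOne (firstToOne (dropLast (((a , K) ∷ M ∷ʳ (b , L)) ∷ʳ (d , l)))))
      ≡⟨ cong (expand ∘ lastToOne ∘ firstToOne) (dropLast-∷ʳ ((a , K) ∷ M ∷ʳ (b , L))) ⟩
    expand (lastToOne (((a , 1) ∷ M) ∷ʳ (b , L)))  ≡⟨ cong expand (lastToOne-∷ʳ ((a , 1) ∷ M) b L) ⟩
    a ∷ expand (M ∷ʳ (b , 1))                      ≡⟨ cong (a ∷_) (expand-++ M [ b , 1 ]) ⟩
    a ∷ expand M ++ b ∷ []                         ∎
    where open ≡-Reasoning

  secondRunLength : List (Char × ℕ) → ℕ
  secondRunLength (_ ∷ (_ , K) ∷ _) = K
  secondRunLength _ = 0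

  offset : List Char → ℕ
  offset x = secondRunLength (runs x)

  headsDiffer-replicate : ∀ {c k} ys → headsDiffer (replicate k c ++ ys) → 1 ≤ k → k ≡ 1
  headsDiffer-replicate {k = 1} _ _ _ = refl
  headsDiffer-replicate {k = suc (suc _)} _ c≢c _ = ⊥-elim (c≢c refl)

  headsDiffer-∷-replicate : ∀ {a e n} ys → a ≢ e → 1 ≤ n → headsDiffer (a ∷ replicate n e ++ ys)
  headsDiffer-∷-replicate {n = suc _} _ a≢e _ = a≢e

  outer-runs-one : ∀ {c k d l} rs → IsBridge (expand ((c , k) ∷ rs ∷ʳ (d , l))) → 1 ≤ k → 1 ≤ l →
    k ≡ 1 × l ≡ 1
  outer-runs-one {c} {k} {d} {l} rs (hd , hd-rev) 1≤k 1≤l =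
    headsDiffer-replicate _ hd 1≤k ,
    headsDiffer-replicate _ (subst headsDiffer (reverse-expand-∷ʳ ((c , k) ∷ rs) d l) hd-rev) 1≤l

  middle-bridge : ∀ c k a K M b L d l → Canonical (((c , k) ∷ (a , K) ∷ M ∷ʳ (b , L)) ∷ʳ (d , l)) →
    IsBridge (a ∷ expand M ++ b ∷ [])
  middle-bridge c k a K M b L d l canonical =
    first-two M canonical ,
    subst headsDiffer (sym (reverse-++ (a ∷ expand M) [ b ])) (last-two (reverseView M) canonical)
    where
    first-two : ∀ M → Canonical (((c , k) ∷ (a , K) ∷ M ∷ʳ (b , L)) ∷ʳ (d , l)) →
      headsDiffer (a ∷ expand M ++ b ∷ [])
    first-two [] (_ , linked) = Linked.head (Linked.tail linked)
    first-two ((_ , suc _) ∷ _) (_ , linked) = Linked.head (Linked.tail linked)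
    first-two ((_ , zero) ∷ _) (pos , _) with All.head (All.tail (All.tail pos))
    ... | ()
    last-two : ∀ {M} → Reverse M → Canonical (((c , k) ∷ (a , K) ∷ M ∷ʳ (b , L)) ∷ʳ (d , l)) →
      headsDiffer (b ∷ reverse (a ∷ expand M))
    last-two [] (_ , linked) = ≢-sym (Linked.head (Linked.tail linked))
    last-two (M′ ∶ _ ∶ʳ (f , n)) (pos , linked) =
      subst (λ r → headsDiffer (b ∷ r)) (sym (reverse-expand-∷ʳ ((a , 1) ∷ M′) f n))
        (headsDiffer-∷-replicate {n = n} _ (≢-sym f≢b) 1≤n)
      where
      front = (c , k) ∷ (a , K) ∷ M′
      f≢b : f ≢ b
      f≢b = Linked-last {xs = front} (Linked-∷ʳ⁻ {xs = (front ∷ʳ (f , n)) ∷ʳ (b , L)} linked)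
      1≤n : 1 ≤ n
      1≤n = proj₂ (∷ʳ⁻ {xs = front} (proj₁ (∷ʳ⁻ {xs = front ∷ʳ (f , n)}
              (proj₁ (∷ʳ⁻ {xs = (front ∷ʳ (f , n)) ∷ʳ (b , L)} pos)))))

  trimRuns-bridge : ∀ {rs} → Shape rs → Canonical rs → 2 ≤ length (trimRuns rs) → IsBridge (trimRuns rs)
  trimRuns-bridge (three _ _ _ _ _ _) _ (s≤s ())
  trimRuns-bridge (more c k a K M b L d l) canonical _ =
    subst IsBridge (sym (trimRuns-more c k a K M b L d l)) (middle-bridge c k a K M b L d l canonical)

  step-bridge : ∀ x → 2 ≤ length (step x) → IsBridge (step x)
  step-bridge x 2≤|z| =
    subst IsBridge (sym z≡)
      (trimRuns-bridge (shape (runs x) 3≤R) (runs-canonical x) (subst (λ z → 2 ≤ length z) z≡ 2≤|z|))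
    where
    3≤R = step≢[]⇒3≤R x (long≢[] 2≤|z|)
    z≡ = step-trimRuns x 3≤R

  bridge≢[] : ∀ {w} → IsBridge w → w ≢ []
  bridge≢[] {[]} (() , _)
  bridge≢[] {_ ∷ _} _ ()

  bridge-length : ∀ {w} → IsBridge w → 2 ≤ length w
  bridge-length {_ ∷ _ ∷ _} _ = s≤s (s≤s z≤n)
  bridge-length {[]} (() , _)
  bridge-length {_ ∷ []} (() , _)

  step-long : ∀ y → 2 ≤ length (step y) → 2 ≤ length y
  step-long (_ ∷ _ ∷ _) _ = s≤s (s≤s z≤n)
  step-long [] ()
  step-long (_ ∷ []) ()

  iter-long : ∀ i y → 2 ≤ length (iter i y) → 2 ≤ length y
  iter-long zero y 2≤ = 2≤
  iter-long (suc i) y 2≤ = iter-long i y (step-long (iter i y) 2≤)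

  iter-suc : ∀ i y → iter (suc i) y ≡ iter i (step y)
  iter-suc zero y = refl
  iter-suc (suc i) y = cong step (iter-suc i y)

  record Extension (z x : List Char) : Set where
    field
      c a b d : Char
      k m : ℕ
      decomposition : x ≡ c ∷ replicate k a ++ z ++ replicate m b ++ d ∷ []
      c≢a : c ≢ a
      d≢b : d ≢ b
      starts-with : ∃ λ z′ → z ≡ a ∷ z′
      ends-with : ∃ λ z′ → z ≡ z′ ∷ʳ b
      offset≡ : offset x ≡ suc k

  extension≢[] : ∀ {z x} → Extension z x → z ≢ []
  extension≢[] E z≡[] with trans (sym (proj₂ (Extension.starts-with E))) z≡[]
  ... | ()

  extension : ∀ {x} → IsBridge x → step x ≢ [] → Extension (step x) x
  extension {x} bx nz =
    subst (λ z → Extension z x) (sym (step-trimRuns x 3≤R))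
      (of-shape (shape (runs x) 3≤R) refl (runs-canonical x) (expand-runs x))
    where
    3≤R = step≢[]⇒3≤R x nz
    of-shape : ∀ {rs} → Shape rs → runs x ≡ rs → Canonical rs → expand rs ≡ x → Extension (trimRuns rs) x
    of-shape (three c k a K d l) eq (pos , linked) ex
      with outer-runs-one ((a , K) ∷ []) (subst IsBridge (sym ex) bx) (All.head pos)
             (All.head (All.tail (All.tail pos)))
         | All.head (All.tail pos)
    ... | refl , refl | s≤s {n = K′} z≤n = record
      { c = c ; a = a ; b = a ; d = d ; k = K′ ; m = 0
      ; decomposition = trans (sym ex) (cong (c ∷_) (replicate-∷ K′ a (d ∷ [])))
      ; c≢a = Linked.head linked
      ; d≢b = ≢-sym (Linked.head (Linked.tail linked))
      ; starts-with = [] , refl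
      ; ends-with = [] , refl
      ; offset≡ = cong secondRunLength eq }
    of-shape (more c k a K M b L d l) eq (pos , linked) ex
      with outer-runs-one ((a , K) ∷ M ∷ʳ (b , L)) (subst IsBridge (sym ex) bx) (All.head pos)
             (proj₂ (∷ʳ⁻ {xs = front ∷ʳ (b , L)} pos))
         | All.head (All.tail pos)
         | proj₂ (∷ʳ⁻ {xs = front} (proj₁ (∷ʳ⁻ {xs = front ∷ʳ (b , L)} pos)))
      where front = (c , k) ∷ (a , K) ∷ M
    ... | refl , refl | s≤s {n = K′} z≤n | s≤s {n = L′} z≤n =
      subst (λ z → Extension z x) (sym (trimRuns-more c 1 a (suc K′) M b (suc L′) d 1)) (record
        { c = c ; a = a ; b = b ; d = d ; k = K′ ; m = L′
        ; decomposition = decomposition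
        ; c≢a = Linked.head linked
        ; d≢b = ≢-sym (Linked-last {xs = (c , 1) ∷ (a , suc K′) ∷ M} linked)
        ; starts-with = expand M ++ b ∷ [] , refl
        ; ends-with = a ∷ expand M , refl
        ; offset≡ = cong secondRunLength eq })
      where
      open ≡-Reasoning
      decomposition : x ≡ c ∷ replicate K′ a ++ (a ∷ expand M ++ b ∷ []) ++ replicate L′ b ++ d ∷ []
      decomposition = begin
        x                                                          ≡⟨ ex ⟨
        c ∷ a ∷ replicate K′ a ++ expand (M ∷ʳ (b , suc L′) ∷ʳ (d , 1))
          ≡⟨ cong (λ r → c ∷ a ∷ replicate K′ a ++ r)
               (trans (cong expand (++-assoc M _ _)) (expand-++ M ((b , suc L′) ∷ (d , 1) ∷ []))) ⟩
        c ∷ a ∷ replicate K′ a ++ expand M ++ b ∷ replicate L′ b ++ d ∷ []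
          ≡⟨ cong (c ∷_) (replicate-∷ K′ a _) ⟩
        c ∷ replicate K′ a ++ a ∷ expand M ++ b ∷ replicate L′ b ++ d ∷ []
          ≡⟨ cong (λ r → c ∷ replicate K′ a ++ a ∷ r) (++-assoc (expand M) [ b ] _) ⟨
        c ∷ replicate K′ a ++ (a ∷ expand M ++ b ∷ []) ++ replicate L′ b ++ d ∷ [] ∎

  -- Occurrences

  isPrefix-sound : ∀ w ys → isPrefix w ys ≡ true → ∃ λ r → ys ≡ w ++ r
  isPrefix-sound [] ys _ = ys , refl
  isPrefix-sound (x ∷ w) (y ∷ ys) eq with x ≟ y
  ... | yes refl = let r , ys≡ = isPrefix-sound w ys eq in r , cong (x ∷_) ys≡

  isPrefix-++ : ∀ w r → isPrefix w (w ++ r) ≡ true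
  isPrefix-++ [] r = refl
  isPrefix-++ (x ∷ w) r with x ≟ x
  ... | yes _ = isPrefix-++ w r
  ... | no x≢x = ⊥-elim (x≢x refl)

  module _ (T : List Char) where

    private
      substringsAt : ℕ → List (List Char)
      substringsAt i = map (λ j → take (suc j) (drop i T)) (upTo (length T ∸ i))

    Pos : List Char → List ℕ
    Pos w = filter (λ i → isPrefix w (drop i T) ≟ᵇ true) (upTo (length T))

    Pos-unique : ∀ w → Unique (Pos w)
    Pos-unique w = Unique.filter⁺ (λ i → isPrefix w (drop i T) ≟ᵇ true) (Unique.upTo⁺ (length T))

    ∈-Pos⁻ : ∀ {w i} → i ∈ Pos w → ∃₂ λ l r → length l ≡ i × T ≡ l ++ w ++ r
    ∈-Pos⁻ {w} {i} i∈ with ∈-filter⁻ (λ i → isPrefix w (drop i T) ≟ᵇ true) {xs = upTo (length T)} i∈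
    ... | i<|T| , prefix with isPrefix-sound w (drop i T) prefix
    ...   | r , drop≡ =
      take i T , r , trans (length-take i T) (m≤n⇒m⊓n≡m (<⇒≤ (∈-upTo⁻ i<|T|))) ,
      trans (sym (take++drop≡id i T)) (cong (take i T ++_) drop≡)

    ∈-Pos⁺ : ∀ {w l r} → w ≢ [] → T ≡ l ++ w ++ r → length l ∈ Pos w
    ∈-Pos⁺ {[]} w≢[] _ = ⊥-elim (w≢[] refl)
    ∈-Pos⁺ {y ∷ w} {l} {r} _ T≡ =
      ∈-filter⁺ (λ i → isPrefix (y ∷ w) (drop i T) ≟ᵇ true) (∈-upTo⁺ |l|<|T|)
        (trans (cong (isPrefix (y ∷ w) ∘ drop (length l)) T≡)
               (trans (cong (isPrefix (y ∷ w)) (drop-length-++ l)) (isPrefix-++ (y ∷ w) r)))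
      where
      |l|<|T| : length l < length T
      |l|<|T| = subst (λ T′ → length l < length T′) (sym T≡) (length-<-++-∷ l)

    occurs : ∀ {w l r} → w ≢ [] → T ≡ l ++ w ++ r → 1 ≤ occ T w
    occurs {l = l} {r} w≢[] T≡ = ∈-length (∈-Pos⁺ {l = l} {r} w≢[] T≡)

    ∈-substrings⁻ : ∀ {y} → y ∈ substrings T → ∃₂ λ l r → T ≡ l ++ y ++ r
    ∈-substrings⁻ y∈
      with find (∈-concatMap⁻ substringsAt {xs = upTo (length T)} (∈-deduplicate⁻ _≟s_ _ y∈))
    ... | i , _ , y∈substringsAt with ∈-map⁻ (λ j → take (suc j) (drop i T)) y∈substringsAt
    ...   | j , _ , refl = take i T , drop (suc j) (drop i T) , (begin
      T                                                               ≡⟨ take++drop≡id i T ⟨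
      take i T ++ drop i T                                            ≡⟨ cong (take i T ++_) (take++drop≡id (suc j) _) ⟨
      take i T ++ take (suc j) (drop i T) ++ drop (suc j) (drop i T)  ∎)
      where open ≡-Reasoning

    ∈-substrings⁺ : ∀ {y l r} → y ≢ [] → T ≡ l ++ y ++ r → y ∈ substrings T
    ∈-substrings⁺ {[]} y≢[] _ = ⊥-elim (y≢[] refl)
    ∈-substrings⁺ {y₀ ∷ y} {l} {r} _ T≡ =
      ∈-deduplicate⁺ _≟s_ (∈-concatMap⁺ substringsAt (lose (∈-upTo⁺ |l|<|T|) y∈substringsAt))
      where
      drop≡ : drop (length l) T ≡ (y₀ ∷ y) ++ r
      drop≡ = trans (cong (drop (length l)) T≡) (drop-length-++ l)
      |l|<|T| : length l < length T
      |l|<|T| = subst (λ T′ → length l < length T′) (sym T≡) (length-<-++-∷ l)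
      |y|<|T|∸|l| : length y < length T ∸ length l
      |y|<|T|∸|l| = subst (length y <_) (trans (cong length (sym drop≡)) (length-drop (length l) T))
                      (s≤s (subst (length y ≤_) (sym (length-++ y)) (m≤m+n (length y) (length r))))
      y∈substringsAt : y₀ ∷ y ∈ substringsAt (length l)
      y∈substringsAt = subst (_∈ substringsAt (length l))
        (trans (cong (take (suc (length y))) drop≡) (take-length-++ (y₀ ∷ y)))
        (∈-map⁺ (λ j → take (suc j) (drop (length l) T)) (∈-upTo⁺ |y|<|T|∸|l|))

    ∈-Bridges⁻ : ∀ {x} → x ∈ Bridges T → (∃₂ λ l r → T ≡ l ++ x ++ r) × IsBridge x
    ∈-Bridges⁻ x∈ with ∈-filter⁻ isBridge? {xs = substrings T} x∈
    ... | x∈substrings , bx = ∈-substrings⁻ x∈substrings , bx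

    Bridges-unique : Unique (Bridges T)
    Bridges-unique = Unique.filter⁺ isBridge? (deduplicate-! _≟s_ (concatMap substringsAt (upTo (length T))))

    extension-occurrence : ∀ {z x l r} (E : Extension z x) → T ≡ l ++ x ++ r →
      let open Extension E in T ≡ (l ++ c ∷ replicate k a) ++ z ++ replicate m b ++ d ∷ r
    extension-occurrence {z} {l = l} {r} E T≡ =
      trans T≡ (trans (cong (λ x′ → l ++ x′ ++ r) decomposition) (regroup-++ l c _ z _ d r))
      where open Extension E

    shift : ∀ {z x i} → Extension z x → i ∈ Pos x → i + offset x ∈ Pos z
    shift {z} {x} E i∈ with ∈-Pos⁻ {x} i∈
    ... | l , r , refl , T≡ =
      subst (_∈ Pos z) (trans (length-++-∷-replicate l c a k) (cong (length l +_) (sym offset≡)))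
        (∈-Pos⁺ {l = l ++ c ∷ replicate k a} (extension≢[] E) (extension-occurrence {l = l} {r} E T≡))
      where open Extension E

    extension-injective : ∀ {z x x′ i i′} → Extension z x → Extension z x′ → i ∈ Pos x → i′ ∈ Pos x′ →
      i + offset x ≡ i′ + offset x′ → x ≡ x′
    extension-injective {x = x} {x′}
      record { c = c ; a = a ; b = b ; d = d ; k = k ; m = m ; decomposition = x≡ ; c≢a = c≢a ; d≢b = d≢b
             ; starts-with = z₀ , refl ; ends-with = z₁ , z≡z₁b ; offset≡ = offset≡ }
      record { c = c′ ; b = b′ ; d = d′ ; k = k′ ; m = m′ ; decomposition = x′≡ ; c≢a = c′≢a ; d≢b = d′≢b
             ; starts-with = _ , refl ; ends-with = z₂ , z≡z₂b′ ; offset≡ = offset≡′ }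
      i∈ i′∈ position
      with ∷ʳ-injectiveʳ z₁ z₂ (trans (sym z≡z₁b) z≡z₂b′) | ∈-Pos⁻ {x} i∈ | ∈-Pos⁻ {x′} i′∈
    ... | refl | l , r , refl , T≡ | l′ , r′ , refl , T≡′ =
      decomposition-unique {z = a ∷ z₀} {l} {l′} {r} {r′} c≢a c′≢a d≢b d′≢b x≡ x′≡
        (trans (sym T≡) T≡′)
        (trans (cong (length l +_) (sym offset≡)) (trans position (cong (length l′ +_) offset≡′)))

    -- The inequality

    ∈-K⁻ : ∀ {z x} → x ∈ K T z → x ∈ Bridges T × step x ≡ z
    ∈-K⁻ {z} = ∈-filter⁻ (λ x → iter 1 x ≟s z) {xs = Bridges T}

    K-extension : ∀ {z x} → z ≢ [] → x ∈ K T z → Extension z x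
    K-extension z≢[] x∈ with ∈-K⁻ x∈
    ... | x∈B , refl = extension (proj₂ (∈-Bridges⁻ x∈B)) z≢[]

    Bridge-occurs : ∀ {x} → x ∈ Bridges T → 1 ≤ occ T x
    Bridge-occurs x∈ with ∈-Bridges⁻ x∈
    ... | (l , r , T≡) , bx = occurs {l = l} {r} (bridge≢[] bx) T≡

    -- Each occurrence of x ∈ K(z) yields one of z, shifted by offset x, and distinct pairs yield distinct ones.
    sum-occ-K≤occ : ∀ {z} → z ≢ [] → sum (map (occ T) (K T z)) ≤ occ T z
    sum-occ-K≤occ {z} z≢[] =
      subst (_≤ occ T z) (cong sum (map-cong (λ x → length-map (_+ offset x) (Pos x)) (K T z)))
        (disjoint-sum-length≤ image (Unique.filter⁺ (λ x → iter 1 x ≟s z) Bridges-unique)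
          (λ {x} _ → Unique.map⁺ (λ {i} {j} → +-cancelʳ-≡ (offset x) i j) (Pos-unique x))
          disjoint image⊆Pos)
      where
      image : List Char → List ℕ
      image x = map (_+ offset x) (Pos x)
      disjoint : ∀ {x x′ q} → x ∈ K T z → x′ ∈ K T z → q ∈ image x → q ∈ image x′ → x ≡ x′
      disjoint {x} {x′} x∈ x′∈ q∈ q∈′ with ∈-map⁻ (_+ offset x) q∈ | ∈-map⁻ (_+ offset x′) q∈′
      ... | i , i∈ , refl | i′ , i′∈ , q≡ =
        extension-injective (K-extension z≢[] x∈) (K-extension z≢[] x′∈) i∈ i′∈ q≡
      image⊆Pos : ∀ {x} → x ∈ K T z → image x ⊆ Pos z
      image⊆Pos {x} x∈ q∈ with ∈-map⁻ (_+ offset x) q∈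
      ... | i , i∈ , refl = shift (K-extension z≢[] x∈) i∈

    surplus : List Char → ℕ
    surplus x = occ T x ∸ 1

    K-surplus : List Char → ℕ
    K-surplus z = sum (map surplus (K T z))

    length+K-surplus≤occ : ∀ {z} → z ≢ [] → length (K T z) + K-surplus z ≤ occ T z
    length+K-surplus≤occ {z} z≢[] =
      subst (_≤ occ T z) (sym (length+sum-pred≡sum (occ T) (K T z) (Bridge-occurs ∘ proj₁ ∘ ∈-K⁻)))
        (sum-occ-K≤occ z≢[])

    step∈Bridges : ∀ {x} → x ∈ Bridges T → 2 ≤ length (step x) → step x ∈ Bridges T
    step∈Bridges {x} x∈ 2≤ with ∈-Bridges⁻ x∈
    ... | (l , r , T≡) , bx =
      ∈-filter⁺ isBridge?
        (∈-substrings⁺ {l = l ++ c ∷ replicate k a} (long≢[] 2≤) (extension-occurrence {l = l} {r} E T≡))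
        (step-bridge x 2≤)
      where
      E = extension bx (long≢[] 2≤)
      open Extension E

    length+K-surplus≤surplus+1 : ∀ {z} → z ∈ Bridges T → length (K T z) + K-surplus z ≤ surplus z + 1
    length+K-surplus≤surplus+1 {z} z∈ =
      subst (length (K T z) + K-surplus z ≤_) (sym (m∸n+n≡m (Bridge-occurs z∈)))
        (length+K-surplus≤occ (bridge≢[] (proj₂ (∈-Bridges⁻ z∈))))

    module _ {w : List Char} (bw : IsBridge w) where

      private
        S F N : ℕ → ℕ
        S i = sum (map surplus (Kt T i w))
        F i = sum (map (λ z → length (K T z)) (Kt+ T i w))
        N i = length (Kt+ T i w)

        Kt⊆Bridges : ∀ {i z} → z ∈ Kt T i w → z ∈ Bridges T
        Kt⊆Bridges {i} = proj₁ ∘ ∈-filter⁻ (λ y → iter i y ≟s w) {xs = Bridges T}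

        -- x ∈ K^(i+1)(w) lies in the fibre K(z) of z = step x ∈ K^(i)(w).
        regroup : ∀ i → S (suc i) ≤ sum (map K-surplus (Kt T i w))
        regroup i =
          sum-filter≤sum-fibres (λ x → iter (suc i) x ≟s w) _≟s_ (iter 1) surplus (Kt T i w) (Bridges T) into
          where
          into : ∀ {x} → x ∈ Bridges T → iter (suc i) x ≡ w → iter 1 x ∈ Kt T i w
          into {x} x∈ iter≡w = ∈-filter⁺ (λ y → iter i y ≟s w) (step∈Bridges x∈ 2≤) iter-step≡w
            where
            iter-step≡w : iter i (step x) ≡ w
            iter-step≡w = trans (sym (iter-suc i x)) iter≡w
            2≤ : 2 ≤ length (step x)
            2≤ = iter-long i (step x) (subst (λ v → 2 ≤ length v) (sym iter-step≡w) (bridge-length bw))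

        layer : ∀ i → F i + S (suc i) ≤ S i + N i
        layer i = begin
          F i + S (suc i)                        ≤⟨ +-monoʳ-≤ (F i) (regroup i) ⟩
          F i + sum (map K-surplus (Kt T i w))   ≤⟨ sum-filter-bound (λ z → 2 ≤? length (K T z)) (λ z → length (K T z))
                                                      K-surplus surplus (Kt T i w) (λ z∈ _ → bound z∈)
                                                      (λ {z} z∈ _ → length+sum≤suc⇒sum≤ surplus (K T z) (bound z∈)) ⟩
          S i + N i                              ∎
          where
          open ≤-Reasoning
          bound : ∀ {z} → z ∈ Kt T i w → length (K T z) + K-surplus z ≤ surplus z + 1
          bound = length+K-surplus≤surplus+1 ∘ Kt⊆Bridges {i}

      K-inequality : ∀ t → length (K T w) + lhsSum T t w ≤ occ T w + rhsSum T t w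
      K-inequality t = ≤-trans (m≤m+n _ (S (suc t))) (telescope F N S base layer t)
        where
        base : length (K T w) + S 1 ≤ occ T w
        base = length+K-surplus≤occ (bridge≢[] bw)

lemma8 : {A : Set} (_≟_ : DecidableEquality A) (s : List A) →
    3 ≤ length (Strings.Text _≟_ s) →
    (w : List (Strings.Char _≟_)) → Strings.IsBridge _≟_ w →
    (t : ℕ) → 1 ≤ t →
    2 ≤ length (Strings.K _≟_ (Strings.Text _≟_ s) w) →
    length (Strings.K _≟_ (Strings.Text _≟_ s) w) + Strings.lhsSum _≟_ (Strings.Text _≟_ s) t w
      ≤ Strings.occ _≟_ (Strings.Text _≟_ s) w + Strings.rhsSum _≟_ (Strings.Text _≟_ s) t w
lemma8 _≟_ s _ w bw t _ _ = K-inequality _≟_ (Strings.Text _≟_ s) bw t
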